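{- Let $H$ be a graph. The corona $H\circ K_1$ has two disjoint maximum independent sets if and only if $H$ is bipartite.
   Context: Graphs are finite, simple, undirected, with non-empty vertex sets. $H\circ K_1$ is the graph obtained from $H$ by attaching, for each vertex $u$ of $H$, a new vertex adjacent only to $u$. An independent set is a set of pairwise non-adjacent vertices; a maximum independent set is one of largest size. -}

module Defs where

open import Data.Nat using (ℕ; _+_; _≤_)
open import Data.Bool using (Bool; true; false)
open import Data.Fin using (Fin; splitAt)
open import Data.Fin.Subset using (Subset; _∈_; _∉_; ∣_∣)
open import Data.Sum using (_⊎_; inj₁; inj₂)
open import Data.Empty using (⊥-elim)
open import Data.Product using (Σ; ∃; _×_)
open import Relation.Binary.PropositionalEquality using (_≡_; _≢_; refl; sym; trans)
open import Relation.Nullary using (¬_; yes; no)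
open import Relation.Nullary.Decidable using (⌊_⌋)
open import Data.Fin.Properties using (_≟_)

record Graph (n : ℕ) : Set where
  field
    adj     : Fin n → Fin n → Bool
    adj-sym : ∀ u v → adj u v ≡ adj v u
    adj-irr : ∀ u → adj u u ≡ false
open Graph public

-- Corona H ∘ K₁ : vertices Fin (n + n); the first copy (inj₁ u) is H,
-- the second copy (inj₂ u) is the pendant vertex u' attached only to u.
coronaAdj : ∀ {n} → Graph n → Fin (n + n) → Fin (n + n) → Bool
coronaAdj {n} H x y with splitAt n x | splitAt n y
... | inj₁ u | inj₁ v = adj H u v
... | inj₁ u | inj₂ v = ⌊ u ≟ v ⌋
... | inj₂ u | inj₁ v = ⌊ u ≟ v ⌋
... | inj₂ u | inj₂ v = false

corona : ∀ {n} → Graph n → Graph (n + n)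
corona {n} H = record
  { adj = coronaAdj H ; adj-sym = csym ; adj-irr = cirr }
  where
  csym : ∀ x y → coronaAdj H x y ≡ coronaAdj H y x
  csym x y with splitAt n x | splitAt n y
  ... | inj₁ u | inj₁ v = adj-sym H u v
  ... | inj₁ u | inj₂ v with u ≟ v | v ≟ u
  ...   | yes _ | yes _ = refl
  ...   | no _  | no _  = refl
  ...   | yes p | no q  = ⊥-elim (q (sym p))
  ...   | no p  | yes q = ⊥-elim (p (sym q))
  csym x y | inj₂ u | inj₁ v with u ≟ v | v ≟ u
  ...   | yes _ | yes _ = refl
  ...   | no _  | no _  = refl
  ...   | yes p | no q  = ⊥-elim (q (sym p))
  ...   | no p  | yes q = ⊥-elim (p (sym q))
  csym x y | inj₂ u | inj₂ v = refl
  cirr : ∀ x → coronaAdj H x x ≡ false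
  cirr x with splitAt n x
  ... | inj₁ u = adj-irr H u
  ... | inj₂ u = refl

Independent : ∀ {n} → Graph n → Subset n → Set
Independent G S = ∀ u v → u ∈ S → v ∈ S → adj G u v ≡ false

MaximumIndependent : ∀ {n} → Graph n → Subset n → Set
MaximumIndependent G S =
  Independent G S × (∀ T → Independent G T → ∣ T ∣ ≤ ∣ S ∣)

Disjoint : ∀ {n} → Subset n → Subset n → Set
Disjoint S T = ∀ v → v ∈ S → v ∉ T

HasTwoDisjointMaxIndep : ∀ {n} → Graph n → Set
HasTwoDisjointMaxIndep G =
  Σ (Subset _) λ S → Σ (Subset _) λ T →
    MaximumIndependent G S × MaximumIndependent G T × Disjoint S T

Bipartite : ∀ {n} → Graph n → Set
Bipartite {n} G = Σ (Fin n → Bool) λ c → ∀ u v → adj G u v ≡ true → c u ≢ c v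

-- A set of the corona H ∘ K₁ on n core vertices is X ++ Y, with X the core part and Y the
-- set of cores whose pendant is chosen. It is independent iff X is independent in H and
-- X, Y are disjoint, so independent sets have size ≤ n; as X ++ ∁ X attains n, the maximum
-- independent sets are exactly the X ++ ∁ X with X independent. Two of them, X ++ ∁ X and
-- X′ ++ ∁ X′, are disjoint iff ∁ X ⊆ X′; so such a pair exists iff X and ∁ X can both be
-- chosen independent, i.e. iff H has a proper 2-colouring.
module Submission where

open import Defs
open import Data.Bool using (Bool; true; false)
open import Data.Bool.Properties using (¬-not)
open import Data.Fin using (Fin; splitAt; _↑ˡ_; _↑ʳ_)
open import Data.Fin.Properties using (_≟_; splitAt-↑ˡ; splitAt-↑ʳ; splitAt⁻¹-↑ˡ; splitAt⁻¹-↑ʳ)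
open import Data.Fin.Subset using (Subset; inside; outside; _∈_; _⊆_; ∣_∣; ∁)
open import Data.Fin.Subset.Properties
  using (_∈?_; x∈p⇒x∉∁p; x∉∁p⇒x∈p; x∈∁p⇒x∉p; x∉p⇒x∈∁p; ∣∁p∣≡n∸∣p∣; ∣p∣≤n; p⊆q⇒∣p∣≤∣q∣; drop-∷-⊆)
open import Data.Nat using (ℕ; suc; _+_; _≤_; s≤s)
open import Data.Nat.Properties
  using (≤-trans; ≤-reflexive; +-monoʳ-≤; +-cancelˡ-≤; m+[n∸m]≡n; 1+n≰n)
open import Data.Product using (∃; _×_; _,_; proj₁; proj₂)
open import Data.Sum using (inj₁; inj₂)
open import Data.Vec using (_∷_; []; _++_; lookup; tabulate; here)
import Data.Vec as Vec
open import Data.Vec.Properties using (lookup-++ˡ; lookup-++ʳ; lookup∘tabulate; []=⇒lookup; lookup⇒[]=)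
open import Function.Bundles using (_⇔_; mk⇔)
open import Relation.Binary.PropositionalEquality using (_≡_; _≢_; refl; sym; trans; cong; subst; subst₂)
open import Relation.Nullary using (does; yes; no; contradiction)
open import Relation.Nullary.Decidable using (isYes≗does; dec-true; dec-false)

private
  variable
    m n : ℕ

data SplitView (m n : ℕ) : Fin (m + n) → Set where
  left  : (i : Fin m) → SplitView m n (i ↑ˡ n)
  right : (j : Fin n) → SplitView m n (m ↑ʳ j)

splitView : ∀ m {n} (x : Fin (m + n)) → SplitView m n x
splitView m {n} x with splitAt m x in eq
... | inj₁ i = subst (SplitView m n) (splitAt⁻¹-↑ˡ eq) (left i)
... | inj₂ j = subst (SplitView m n) (splitAt⁻¹-↑ʳ eq) (right j)

module _ {p : Subset m} {q : Subset n} where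

  ∈-++⁺ˡ : ∀ {i} → i ∈ p → i ↑ˡ n ∈ p ++ q
  ∈-++⁺ˡ {i} i∈p = lookup⇒[]= (i ↑ˡ n) (p ++ q) (trans (lookup-++ˡ p q i) ([]=⇒lookup i∈p))

  ∈-++⁺ʳ : ∀ {j} → j ∈ q → m ↑ʳ j ∈ p ++ q
  ∈-++⁺ʳ {j} j∈q = lookup⇒[]= (m ↑ʳ j) (p ++ q) (trans (lookup-++ʳ p q j) ([]=⇒lookup j∈q))

  ∈-++⁻ˡ : ∀ {i} → i ↑ˡ n ∈ p ++ q → i ∈ p
  ∈-++⁻ˡ {i} h = lookup⇒[]= i p (trans (sym (lookup-++ˡ p q i)) ([]=⇒lookup h))

  ∈-++⁻ʳ : ∀ {j} → m ↑ʳ j ∈ p ++ q → j ∈ q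
  ∈-++⁻ʳ {j} h = lookup⇒[]= j q (trans (sym (lookup-++ʳ p q j)) ([]=⇒lookup h))

∣p++q∣≡∣p∣+∣q∣ : (p : Subset m) (q : Subset n) → ∣ p ++ q ∣ ≡ ∣ p ∣ + ∣ q ∣
∣p++q∣≡∣p∣+∣q∣ []            q = refl
∣p++q∣≡∣p∣+∣q∣ (inside  ∷ p) q = cong suc (∣p++q∣≡∣p∣+∣q∣ p q)
∣p++q∣≡∣p∣+∣q∣ (outside ∷ p) q = ∣p++q∣≡∣p∣+∣q∣ p q

∣p∣+∣∁p∣≡n : (p : Subset n) → ∣ p ∣ + ∣ ∁ p ∣ ≡ n
∣p∣+∣∁p∣≡n p = trans (cong (∣ p ∣ +_) (∣∁p∣≡n∸∣p∣ p)) (m+[n∸m]≡n (∣p∣≤n p))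

p⊆q∧∣q∣≤∣p∣⇒p≡q : {p q : Subset n} → p ⊆ q → ∣ q ∣ ≤ ∣ p ∣ → p ≡ q
p⊆q∧∣q∣≤∣p∣⇒p≡q {p = []}          {[]}          _   _ = refl
p⊆q∧∣q∣≤∣p∣⇒p≡q {p = inside  ∷ p} {outside ∷ q} p⊆q _ = contradiction (p⊆q here) λ ()
p⊆q∧∣q∣≤∣p∣⇒p≡q {p = inside  ∷ p} {inside  ∷ q} p⊆q (s≤s ∣q∣≤∣p∣) =
  cong (inside ∷_) (p⊆q∧∣q∣≤∣p∣⇒p≡q (drop-∷-⊆ p⊆q) ∣q∣≤∣p∣)
p⊆q∧∣q∣≤∣p∣⇒p≡q {p = outside ∷ p} {outside ∷ q} p⊆q ∣q∣≤∣p∣ =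
  cong (outside ∷_) (p⊆q∧∣q∣≤∣p∣⇒p≡q (drop-∷-⊆ p⊆q) ∣q∣≤∣p∣)
p⊆q∧∣q∣≤∣p∣⇒p≡q {p = outside ∷ p} {inside  ∷ q} p⊆q ∣q∣<∣p∣ =
  contradiction (≤-trans ∣q∣<∣p∣ (p⊆q⇒∣p∣≤∣q∣ (drop-∷-⊆ p⊆q))) 1+n≰n

disjoint-∁ : (p : Subset n) → Disjoint p (∁ p)
disjoint-∁ p x = x∈p⇒x∉∁p

disjoint⇒⊆∁ : {p q : Subset n} → Disjoint p q → q ⊆ ∁ p
disjoint⇒⊆∁ p∩q≡∅ {x} x∈q = x∉p⇒x∈∁p (λ x∈p → p∩q≡∅ x x∈p x∈q)

disjoint⇒∣p∣+∣q∣≤n : {p q : Subset n} → Disjoint p q → ∣ p ∣ + ∣ q ∣ ≤ n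
disjoint⇒∣p∣+∣q∣≤n {p = p} p∩q≡∅ =
  ≤-trans (+-monoʳ-≤ ∣ p ∣ (p⊆q⇒∣p∣≤∣q∣ (disjoint⇒⊆∁ p∩q≡∅))) (≤-reflexive (∣p∣+∣∁p∣≡n p))

module _ {p p′ : Subset m} {q q′ : Subset n} where

  disjoint-++⁺ : Disjoint p p′ → Disjoint q q′ → Disjoint (p ++ q) (p′ ++ q′)
  disjoint-++⁺ dp dq x with splitView m x
  ... | left  i = λ i∈ i∈′ → dp i (∈-++⁻ˡ i∈) (∈-++⁻ˡ i∈′)
  ... | right j = λ j∈ j∈′ → dq j (∈-++⁻ʳ j∈) (∈-++⁻ʳ j∈′)

  disjoint-++⁻ʳ : Disjoint (p ++ q) (p′ ++ q′) → Disjoint q q′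
  disjoint-++⁻ʳ d j j∈q j∈q′ = d (m ↑ʳ j) (∈-++⁺ʳ j∈q) (∈-++⁺ʳ j∈q′)

∁p∩∁q≡∅⇒∁p⊆q : {p q : Subset n} → Disjoint (∁ p) (∁ q) → ∁ p ⊆ q
∁p∩∁q≡∅⇒∁p⊆q ∁p∩∁q≡∅ {x} x∈∁p = x∉∁p⇒x∈p (∁p∩∁q≡∅ x x∈∁p)

independent-⊆ : (G : Graph n) {S T : Subset n} → S ⊆ T → Independent G T → Independent G S
independent-⊆ G S⊆T T-indep u v u∈S v∈S = T-indep u v (S⊆T u∈S) (S⊆T v∈S)

module Corona (H : Graph n) where

  corona-core : ∀ u v → adj (corona H) (u ↑ˡ n) (v ↑ˡ n) ≡ adj H u v
  corona-core u v rewrite splitAt-↑ˡ n u n | splitAt-↑ˡ n v n = refl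

  corona-pendant : ∀ u v → adj (corona H) (u ↑ˡ n) (n ↑ʳ v) ≡ does (u ≟ v)
  corona-pendant u v rewrite splitAt-↑ˡ n u n | splitAt-↑ʳ n n v = isYes≗does (u ≟ v)

  corona-leaves : ∀ u v → adj (corona H) (n ↑ʳ u) (n ↑ʳ v) ≡ false
  corona-leaves u v rewrite splitAt-↑ʳ n n u | splitAt-↑ʳ n n v = refl

  pendant-edge : ∀ u → adj (corona H) (u ↑ˡ n) (n ↑ʳ u) ≡ true
  pendant-edge u = trans (corona-pendant u u) (dec-true (u ≟ u) refl)

  disjoint⇒no-pendant-edge : {X Y : Subset n} → Disjoint X Y →
                             ∀ {u v} → u ∈ X → v ∈ Y → adj (corona H) (u ↑ˡ n) (n ↑ʳ v) ≡ false
  disjoint⇒no-pendant-edge X∩Y≡∅ {u} {v} u∈X v∈Y =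
    trans (corona-pendant u v) (dec-false (u ≟ v) λ { refl → X∩Y≡∅ u u∈X v∈Y })

  independent-corona⁺ : {X Y : Subset n} → Independent H X → Disjoint X Y →
                        Independent (corona H) (X ++ Y)
  independent-corona⁺ X-indep X∩Y≡∅ x y x∈ y∈ with splitView n x | splitView n y
  ... | left  u | left  v = trans (corona-core u v) (X-indep u v (∈-++⁻ˡ x∈) (∈-++⁻ˡ y∈))
  ... | left  u | right v = disjoint⇒no-pendant-edge X∩Y≡∅ (∈-++⁻ˡ x∈) (∈-++⁻ʳ y∈)
  ... | right u | left  v = trans (adj-sym (corona H) (n ↑ʳ u) (v ↑ˡ n))
                                  (disjoint⇒no-pendant-edge X∩Y≡∅ (∈-++⁻ˡ y∈) (∈-++⁻ʳ x∈))
  ... | right u | right v = corona-leaves u v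

  independent-corona⁻ : {X Y : Subset n} → Independent (corona H) (X ++ Y) →
                        Independent H X × Disjoint X Y
  independent-corona⁻ {X} {Y} indep = X-indep , X∩Y≡∅
    where
    X-indep : Independent H X
    X-indep u v u∈X v∈X = trans (sym (corona-core u v)) (indep _ _ (∈-++⁺ˡ u∈X) (∈-++⁺ˡ v∈X))
    X∩Y≡∅ : Disjoint X Y
    X∩Y≡∅ u u∈X u∈Y =
      contradiction (trans (sym (pendant-edge u)) (indep _ _ (∈-++⁺ˡ u∈X) (∈-++⁺ʳ u∈Y))) λ ()

  independent-corona-size : {T : Subset (n + n)} → Independent (corona H) T → ∣ T ∣ ≤ n
  independent-corona-size {T} indep with Vec.splitAt n T
  ... | X , Y , refl = subst (_≤ n) (sym (∣p++q∣≡∣p∣+∣q∣ X Y))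
                             (disjoint⇒∣p∣+∣q∣≤n (proj₂ (independent-corona⁻ {X} {Y} indep)))

  maximumIndependent-corona⁺ : {X : Subset n} → Independent H X →
                               MaximumIndependent (corona H) (X ++ ∁ X)
  maximumIndependent-corona⁺ {X} X-indep =
    independent-corona⁺ X-indep (disjoint-∁ X) ,
    λ T T-indep → subst (∣ T ∣ ≤_) (sym ∣X++∁X∣≡n) (independent-corona-size T-indep)
    where
    ∣X++∁X∣≡n : ∣ X ++ ∁ X ∣ ≡ n
    ∣X++∁X∣≡n = trans (∣p++q∣≡∣p∣+∣q∣ X (∁ X)) (∣p∣+∣∁p∣≡n X)

  maximumIndependent-corona⁻ : {X Y : Subset n} → MaximumIndependent (corona H) (X ++ Y) →
                               Independent H X × Y ≡ ∁ X
  maximumIndependent-corona⁻ {X} {Y} (indep , maximal) =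
    X-indep , p⊆q∧∣q∣≤∣p∣⇒p≡q (disjoint⇒⊆∁ X∩Y≡∅) (+-cancelˡ-≤ ∣ X ∣ _ _ ∣X∣+∣∁X∣≤∣X∣+∣Y∣)
    where
    X-indep : Independent H X
    X-indep = proj₁ (independent-corona⁻ indep)
    X∩Y≡∅ : Disjoint X Y
    X∩Y≡∅ = proj₂ (independent-corona⁻ indep)
    ∣X∣+∣∁X∣≤∣X∣+∣Y∣ : ∣ X ∣ + ∣ ∁ X ∣ ≤ ∣ X ∣ + ∣ Y ∣
    ∣X∣+∣∁X∣≤∣X∣+∣Y∣ = subst₂ _≤_ (∣p++q∣≡∣p∣+∣q∣ X (∁ X)) (∣p++q∣≡∣p∣+∣q∣ X Y)
                         (maximal (X ++ ∁ X) (independent-corona⁺ X-indep (disjoint-∁ X)))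

module _ (G : Graph n) where

  same-colour⇒non-adjacent : (c : Fin n → Bool) → (∀ u v → adj G u v ≡ true → c u ≢ c v) →
                             ∀ {u v} → c u ≡ c v → adj G u v ≡ false
  same-colour⇒non-adjacent c proper {u} {v} cu≡cv with adj G u v in uv
  ... | true  = contradiction cu≡cv (proper u v uv)
  ... | false = refl

  bipartite⇒complement-independent : Bipartite G → ∃ λ X → Independent G X × Independent G (∁ X)
  bipartite⇒complement-independent (c , proper) =
    tabulate c , monochromatic ∈X⇒true , monochromatic ∈∁X⇒false
    where
    monochromatic : ∀ {S b} → (∀ {u} → u ∈ S → c u ≡ b) → Independent G S
    monochromatic colour u v u∈S v∈S =
      same-colour⇒non-adjacent c proper (trans (colour u∈S) (sym (colour v∈S)))
    ∈X⇒true : ∀ {u} → u ∈ tabulate c → c u ≡ true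
    ∈X⇒true {u} u∈X = trans (sym (lookup∘tabulate c u)) ([]=⇒lookup u∈X)
    ∈∁X⇒false : ∀ {u} → u ∈ ∁ (tabulate c) → c u ≡ false
    ∈∁X⇒false {u} u∈∁X =
      ¬-not (λ cu≡true → x∈∁p⇒x∉p u∈∁X (lookup⇒[]= u (tabulate c) (trans (lookup∘tabulate c u) cu≡true)))

  complement-independent⇒bipartite : ∀ {X} → Independent G X → Independent G (∁ X) → Bipartite G
  complement-independent⇒bipartite {X} X-indep ∁X-indep = (λ u → does (u ∈? X)) , proper
    where
    proper : ∀ u v → adj G u v ≡ true → does (u ∈? X) ≢ does (v ∈? X)
    proper u v uv with u ∈? X | v ∈? X
    ... | yes u∈X | yes v∈X = λ _ → contradiction (trans (sym uv) (X-indep u v u∈X v∈X)) λ ()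
    ... | no  u∉X | no  v∉X = λ _ →
      contradiction (trans (sym uv) (∁X-indep u v (x∉p⇒x∈∁p u∉X) (x∉p⇒x∈∁p v∉X))) λ ()
    ... | yes _   | no  _   = λ ()
    ... | no  _   | yes _   = λ ()

theorem5p1 : ∀ (m : ℕ) (H : Graph (suc m)) →
    HasTwoDisjointMaxIndep (corona H) ⇔ Bipartite H
theorem5p1 m H = mk⇔ twoDisjoint⇒bipartite bipartite⇒twoDisjoint
  where
  open Corona H
  twoDisjoint⇒bipartite : HasTwoDisjointMaxIndep (corona H) → Bipartite H
  twoDisjoint⇒bipartite (S , T , S-max , T-max , S∩T≡∅) with Vec.splitAt (suc m) S | Vec.splitAt (suc m) T
  ... | X , Y , refl | X′ , Y′ , refl
    with maximumIndependent-corona⁻ {X} {Y} S-max | maximumIndependent-corona⁻ {X′} {Y′} T-max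
  ... | X-indep , refl | X′-indep , refl =
    complement-independent⇒bipartite H X-indep
      (independent-⊆ H (∁p∩∁q≡∅⇒∁p⊆q (disjoint-++⁻ʳ {p = X} {X′} {∁ X} {∁ X′} S∩T≡∅)) X′-indep)
  bipartite⇒twoDisjoint : Bipartite H → HasTwoDisjointMaxIndep (corona H)
  bipartite⇒twoDisjoint bip with bipartite⇒complement-independent H bip
  ... | X , X-indep , ∁X-indep =
    X ++ ∁ X , ∁ X ++ ∁ (∁ X) ,
    maximumIndependent-corona⁺ X-indep , maximumIndependent-corona⁺ ∁X-indep ,
    disjoint-++⁺ {p = X} {q = ∁ X} (disjoint-∁ X) (disjoint-∁ (∁ X))
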